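{- Let $T$ be a standard Young tableau with three rows. Its $\mathsf{m}$-diagram satisfies: (1) at most two arcs pass through any given point; (2) if two arcs cross, then one of them is a first arc (belonging to an $\mathsf{m}$ or an isolated arc) and the other is the second arc of a different $\mathsf{m}$; (3) any two $\mathsf{m}$s cross at most once (the union of the arcs of one meets the union of the arcs of the other in at most one point above the line); (4) for any two distinct $\mathsf{m}$s $(a,b,c)$ and $(a',b',c')$ with $a<a'$, exactly one of the following holds: $c<a'$; $b<a'<c'<c$; $a<a'<c'<b$; $a<a'<b'<b<c<c'$; $a<b<a'<c<b'<c'$.
   Context: Tableau conventions: rows are left-justified and numbered from the bottom (bottom row longest); a standard Young tableau with $N$ boxes is a filling by $1,\dots,N$, each once, increasing left to right along rows and bottom to top along columns. $\mathsf{m}$-diagram: place points $1,\dots,N$ in order on a horizontal line $\ell$; for $i=1,\dots,N$ in increasing order, if $i$ lies in row $r+1$ ($r\ge 1$), join $i$ by an arc (the upper semicircle with diameter $[j,i]$) to the largest entry $j<i$ of row $r$ that is not already joined by an arc to an entry of row $r+1$. Arcs between rows 1 and 2 are first arcs; arcs between rows 2 and 3 are second arcs. An $\mathsf{m}$ is a triple $a<b<c$ such that $(a,b)$ and $(b,c)$ are arcs and these are the only arcs incident to $a,b,c$; its first arc is $(a,b)$ and its second arc is $(b,c)$. An isolated arc is an arc $(a,b)$ which is the only arc incident to $a$ or $b$. Two arcs cross if they meet at a point above $\ell$. -}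

module Defs where

open import Data.Nat using (ℕ; zero; suc; _<_; _≤_; _<?_; _≟_; _⊔_)
open import Data.List using (List; []; _∷_; _++_; [_]; length; map; filter; foldl; foldr; upTo; take)
open import Data.List.Membership.Propositional using (_∈_)
open import Data.List.Relation.Unary.Any using (any?)
open import Data.List.Relation.Unary.Linked using (Linked)
open import Data.List.Relation.Binary.Pointwise using (Pointwise)
open import Data.List.Relation.Binary.Permutation.Propositional using (_↭_)
open import Data.Maybe using (Maybe; nothing; just)
open import Data.Product using (_×_; _,_; proj₁; proj₂; ∃-syntax)
open import Data.Sum using (_⊎_)
open import Data.Bool using (if_then_else_)
open import Relation.Nullary using (¬_; does; ¬?)
open import Relation.Nullary.Decidable using (_×-dec_)
open import Relation.Binary.PropositionalEquality using (_≡_; _≢_)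

-- Standard Young tableaux with exactly three rows
-- Rows are numbered from the bottom: row₁ is the bottom (longest) row.
-- Each row is listed left to right.

record SYT3 (N : ℕ) : Set where
  field
    row₁ row₂ row₃ : List ℕ
    row₃-nonempty : 1 ≤ length row₃
    len₃≤len₂     : length row₃ ≤ length row₂
    len₂≤len₁     : length row₂ ≤ length row₁
    inc₁ : Linked _<_ row₁
    inc₂ : Linked _<_ row₂
    inc₃ : Linked _<_ row₃
    col₁₂ : Pointwise _<_ (take (length row₂) row₁) row₂
    col₂₃ : Pointwise _<_ (take (length row₃) row₂) row₃
    entries : (row₁ ++ row₂ ++ row₃) ↭ map suc (upTo N)

open SYT3 public

-- An arc (j , i) is the upper semicircle with diameter [j , i], j < i.
Arc : Set
Arc = ℕ × ℕ

record Diagram : Set where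
  constructor mkDiagram
  field
    firstArcs  : List Arc   -- arcs between rows 1 and 2
    secondArcs : List Arc   -- arcs between rows 2 and 3

open Diagram public

arcs : Diagram → List Arc
arcs D = firstArcs D ++ secondArcs D

maxList : List ℕ → Maybe ℕ
maxList []       = nothing
maxList (x ∷ xs) = just (foldr _⊔_ x xs)

largestFree : ℕ → List ℕ → List ℕ → Maybe ℕ
largestFree i row used =
  maxList (filter (λ j → (j <? i) ×-dec ¬? (any? (j ≟_) used)) row)

-- join i to the largest free j < i of 'row'; 'as' are the arcs already
-- drawn between 'row' and the next row (their left ends are used)
joinTo : ℕ → List ℕ → List Arc → List Arc
joinTo i row as with largestFree i row (map proj₁ as)
... | nothing = as
... | just j  = as ++ [ (j , i) ]

step : List ℕ → List ℕ → List ℕ → Diagram → ℕ → Diagram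
step r₁ r₂ r₃ (mkDiagram fs ss) i =
  if does (any? (i ≟_) r₂)
  then mkDiagram (joinTo i r₁ fs) ss
  else (if does (any? (i ≟_) r₃)
        then mkDiagram fs (joinTo i r₂ ss)
        else mkDiagram fs ss)

mDiagram : ∀ {N} → SYT3 N → Diagram
mDiagram {N} T =
  foldl (step (row₁ T) (row₂ T) (row₃ T)) (mkDiagram [] []) (map suc (upTo N))

Incident : ℕ → Arc → Set
Incident v (a , b) = v ≡ a ⊎ v ≡ b

-- two semicircles meet above ℓ iff their endpoints strictly interleave
Cross : Arc → Arc → Set
Cross (a , b) (c , d) = (a < c × c < b × b < d) ⊎ (c < a × a < d × d < b)

IsM : Diagram → ℕ → ℕ → ℕ → Set
IsM D a b c =
  a < b × b < c × (a , b) ∈ arcs D × (b , c) ∈ arcs D ×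
  (∀ e → e ∈ arcs D → Incident a e ⊎ Incident b e ⊎ Incident c e →
         e ≡ (a , b) ⊎ e ≡ (b , c))

ArcOfM : ℕ → ℕ → ℕ → Arc → Set
ArcOfM a b c e = e ≡ (a , b) ⊎ e ≡ (b , c)

IsolatedArc : Diagram → Arc → Set
IsolatedArc D (a , b) =
  (a , b) ∈ arcs D ×
  (∀ f → f ∈ arcs D → Incident a f ⊎ Incident b f → f ≡ (a , b))

DistinctTriples : ℕ → ℕ → ℕ → ℕ → ℕ → ℕ → Set
DistinctTriples a b c a' b' c' = ¬ (a ≡ a' × b ≡ b' × c ≡ c')

FirstVsSecond : Diagram → Arc → Arc → Set
FirstVsSecond D (a , b) (b' , c') =
  (a , b) ∈ firstArcs D ×
  ((∃[ c ] ∃[ a' ] (IsM D a b c × IsM D a' b' c' × DistinctTriples a b c a' b' c'))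
   ⊎ (IsolatedArc D (a , b) × ∃[ a' ] IsM D a' b' c'))

ExactlyOne5 : Set → Set → Set → Set → Set → Set
ExactlyOne5 P₁ P₂ P₃ P₄ P₅ =
  (P₁ ⊎ P₂ ⊎ P₃ ⊎ P₄ ⊎ P₅) ×
  ¬ (P₁ × P₂) × ¬ (P₁ × P₃) × ¬ (P₁ × P₄) × ¬ (P₁ × P₅) ×
  ¬ (P₂ × P₃) × ¬ (P₂ × P₄) × ¬ (P₂ × P₅) ×
  ¬ (P₃ × P₄) × ¬ (P₃ × P₅) ×
  ¬ (P₄ × P₅)

-- (1) at most two arcs pass through any point: at a point of ℓ (a vertex),
-- and above ℓ (no three arcs pairwise cross, hence none are concurrent)
Property1 : Diagram → Set
Property1 D =
  (∀ v {e₁ e₂ e₃} → e₁ ∈ arcs D → e₂ ∈ arcs D → e₃ ∈ arcs D →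
     Incident v e₁ → Incident v e₂ → Incident v e₃ →
     e₁ ≡ e₂ ⊎ e₁ ≡ e₃ ⊎ e₂ ≡ e₃)
  ×
  (∀ {e₁ e₂ e₃} → e₁ ∈ arcs D → e₂ ∈ arcs D → e₃ ∈ arcs D →
     ¬ (Cross e₁ e₂ × Cross e₁ e₃ × Cross e₂ e₃))

Property2 : Diagram → Set
Property2 D =
  ∀ {e f} → e ∈ arcs D → f ∈ arcs D → Cross e f →
    FirstVsSecond D e f ⊎ FirstVsSecond D f e

Property3 : Diagram → Set
Property3 D =
  ∀ {a b c a' b' c'} → IsM D a b c → IsM D a' b' c' →
    DistinctTriples a b c a' b' c' →
    ∀ {e₁ f₁ e₂ f₂} →
      ArcOfM a b c e₁ → ArcOfM a' b' c' f₁ → Cross e₁ f₁ →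
      ArcOfM a b c e₂ → ArcOfM a' b' c' f₂ → Cross e₂ f₂ →
      e₁ ≡ e₂ × f₁ ≡ f₂

Property4 : Diagram → Set
Property4 D =
  ∀ {a b c a' b' c'} → IsM D a b c → IsM D a' b' c' →
    DistinctTriples a b c a' b' c' → a < a' →
    ExactlyOne5
      (c < a')
      (b < a' × a' < c' × c' < c)
      (a < a' × a' < c' × c' < b)
      (a < a' × a' < b' × b' < b × b < c × c < c')
      (a < b × b < a' × a' < c × c < b' × b' < c')

module Submission where

-- The m-diagram consists of two greedy matchings built independently: the
-- first arcs join row 2 to row 1 and the second arcs join row 3 to row 2,
-- each entry i of the upper row being joined to the largest still-free entry
-- j < i of the lower row.  The heart of the proof is an invariant of such a
-- greedy matching between a strictly increasing row R and a row R' resting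
-- on it (module GreedyMatching): arcs go from R up to R', an arc is
-- determined by either endpoint, arcs of one matching never cross, and every
-- entry of R' receives an arc -- the last point is a counting argument in
-- which column strictness supplies more entries of R than of R' below i.  As the three rows are disjoint, a vertex lies on at most one
-- arc of each kind and only arcs of different kinds can cross; an m is just
-- a first arc followed by a second arc.

open import Defs
open import Data.Nat using (ℕ; zero; suc; _+_; _<_; _≤_; _⊔_; z≤n; s≤s)
open import Data.Nat.Properties
open import Data.List using (List; []; _∷_; _++_; [_]; length; map; filter; foldl; upTo; take)
open import Data.List.Properties using (filter-accept; filter-reject; map-++; length-++; length-map; foldl-∷ʳ; upTo-∷ʳ; foldr-preservesᵒ)
open import Data.List.Membership.Propositional using (_∈_; _∉_; find; lose)
open import Data.List.Membership.Propositional.Properties using (∈-map⁺; ∈-map⁻; ∈-++⁺ˡ; ∈-++⁺ʳ; ∈-++⁻; ∈-filter⁺; ∈-filter⁻; ∈-∃++; ∈-upTo⁻; foldr-selective)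
open import Data.List.Relation.Unary.Any using (Any; here; there; any?)
open import Data.List.Relation.Unary.All using (all?)
import Data.List.Relation.Unary.All as All
open import Data.List.Relation.Unary.All.Properties using (¬All⇒Any¬)
import Data.List.Relation.Unary.AllPairs as AllPairs
open import Data.List.Relation.Unary.Unique.Propositional using (Unique; []; _∷_)
import Data.List.Relation.Unary.Unique.Propositional.Properties as Unique
open import Data.List.Relation.Unary.Linked using (Linked)
open import Data.List.Relation.Unary.Linked.Properties using (Linked⇒AllPairs)
open import Data.List.Relation.Binary.Pointwise using (Pointwise; []; _∷_)
open import Data.List.Relation.Binary.Permutation.Propositional using (_↭_; ↭-sym; ↭⇒↭ₛ)
open import Data.List.Relation.Binary.Permutation.Propositional.Properties using (∈-resp-↭)
import Data.List.Relation.Binary.Permutation.Setoid.Properties as PermutationSetoid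
open import Data.Maybe using (nothing; just)
open import Data.Product using (_×_; _,_; proj₁; proj₂; ∃-syntax)
open import Data.Sum using (_⊎_; inj₁; inj₂)
open import Data.Empty using (⊥-elim)
open import Relation.Nullary using (¬_; Dec; yes; no; ¬?)
open import Relation.Nullary.Decidable using (_×-dec_)
open import Relation.Binary using (tri<; tri≈; tri>)
open import Relation.Binary.PropositionalEquality using (_≡_; _≢_; refl; sym; cong; subst; setoid; module ≡-Reasoning)

unique-resp-↭ : ∀ {xs ys : List ℕ} → xs ↭ ys → Unique xs → Unique ys
unique-resp-↭ p = PermutationSetoid.Unique-resp-↭ (setoid ℕ) (↭⇒↭ₛ p)

unique-++-disjoint : ∀ (xs : List ℕ) {ys x} → Unique (xs ++ ys) → x ∈ xs → x ∉ ys
unique-++-disjoint (z ∷ xs) (z∉ ∷ _) (here refl) x∈ys = All.lookup z∉ (∈-++⁺ʳ xs x∈ys) refl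
unique-++-disjoint (z ∷ xs) (_ ∷ u)  (there x∈xs) x∈ys = unique-++-disjoint xs u x∈xs x∈ys

unique-++ʳ : ∀ (xs : List ℕ) {ys} → Unique (xs ++ ys) → Unique ys
unique-++ʳ []       u       = u
unique-++ʳ (x ∷ xs) (_ ∷ u) = unique-++ʳ xs u

distinct-of-disjoint : ∀ {xs ys : List ℕ} {x y} → (∀ {z} → z ∈ xs → z ∉ ys) → x ∈ xs → y ∈ ys → x ≢ y
distinct-of-disjoint disjoint x∈ y∈ refl = disjoint x∈ y∈

unique-map-injective : ∀ {A B : Set} (f : A → B) {xs x y} → Unique (map f xs) →
                       x ∈ xs → y ∈ xs → f x ≡ f y → x ≡ y
unique-map-injective f (_ ∷ _)   (here refl) (here refl) _ = refl
unique-map-injective f (fz∉ ∷ _) (here refl) (there y∈) e  = ⊥-elim (All.lookup fz∉ (∈-map⁺ f y∈) e)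
unique-map-injective f (fz∉ ∷ _) (there x∈)  (here refl) e = ⊥-elim (All.lookup fz∉ (∈-map⁺ f x∈) (sym e))
unique-map-injective f (_ ∷ u)   (there x∈)  (there y∈) e  = unique-map-injective f u x∈ y∈ e

∈-take : ∀ n {xs : List ℕ} {x} → x ∈ take n xs → x ∈ xs
∈-take (suc n) {y ∷ xs} (here x≡y)  = here x≡y
∈-take (suc n) {y ∷ xs} (there x∈)  = there (∈-take n x∈)

∈-∷ʳ⁻ : ∀ {A : Set} {xs : List A} {e x} → e ∈ xs ++ [ x ] → e ∈ xs ⊎ e ≡ x
∈-∷ʳ⁻ {xs = xs} e∈ with ∈-++⁻ xs e∈
... | inj₁ e∈xs       = inj₁ e∈xs
... | inj₂ (here e≡x) = inj₂ e≡x

∈-remove : ∀ (us : List ℕ) {ws x y} → y ∈ us ++ x ∷ ws → y ≢ x → y ∈ us ++ ws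
∈-remove []       (here y≡x) y≢x = ⊥-elim (y≢x y≡x)
∈-remove []       (there y∈) _   = y∈
∈-remove (u ∷ us) (here y≡u) _   = here y≡u
∈-remove (u ∷ us) (there y∈) y≢x = there (∈-remove us y∈ y≢x)

length-insert : ∀ (us : List ℕ) x ws → length (us ++ x ∷ ws) ≡ suc (length (us ++ ws))
length-insert us x ws = begin
  length (us ++ x ∷ ws)          ≡⟨ length-++ us ⟩
  length us + suc (length ws)    ≡⟨ +-suc (length us) (length ws) ⟩
  suc (length us + length ws)    ≡⟨ cong suc (sym (length-++ us)) ⟩
  suc (length (us ++ ws))        ∎
  where open ≡-Reasoning

pigeonhole : ∀ {xs ys : List ℕ} → Unique xs → (∀ {x} → x ∈ xs → x ∈ ys) → length xs ≤ length ys
pigeonhole {[]}     _          _   = z≤n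
pigeonhole {x ∷ xs} (x∉ ∷ u) sub with ∈-∃++ (sub (here refl))
... | us , ws , refl = subst (suc (length xs) ≤_) (sym (length-insert us x ws))
  (s≤s (pigeonhole u λ y∈xs → ∈-remove us (sub (there y∈xs)) λ y≡x → All.lookup x∉ y∈xs (sym y≡x)))

maxList-member : ∀ {xs m} → maxList xs ≡ just m → m ∈ xs
maxList-member {x ∷ xs} refl with foldr-selective ⊔-sel x xs
... | inj₁ m≡x  = here m≡x
... | inj₂ m∈xs = there m∈xs

maxList-upper : ∀ {xs m y} → maxList xs ≡ just m → y ∈ xs → y ≤ m
maxList-upper {x ∷ xs} {y = y} refl y∈ = foldr-preservesᵒ bound x xs (start y∈)
  where
  bound : ∀ u v → y ≤ u ⊎ y ≤ v → y ≤ u ⊔ v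
  bound u v (inj₁ y≤u) = ≤-trans y≤u (m≤m⊔n u v)
  bound u v (inj₂ y≤v) = ≤-trans y≤v (m≤n⊔m u v)
  start : y ∈ x ∷ xs → y ≤ x ⊎ Any (y ≤_) xs
  start (here refl)  = inj₁ ≤-refl
  start (there y∈xs) = inj₂ (lose y∈xs ≤-refl)

maxList-nothing : ∀ {xs y} → maxList xs ≡ nothing → y ∉ xs
maxList-nothing {x ∷ xs} ()

#below : ℕ → List ℕ → ℕ
#below I xs = length (filter (_<? I) xs)

below-accept : ∀ I {x} xs → x < I → #below I (x ∷ xs) ≡ suc (#below I xs)
below-accept I xs x<I = cong length (filter-accept (_<? I) {xs = xs} x<I)

below-reject : ∀ I {x} xs → ¬ x < I → #below I (x ∷ xs) ≡ #below I xs
below-reject I xs x≮I = cong length (filter-reject (_<? I) {xs = xs} x≮I)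

pointwise-below : ∀ {P Q : List ℕ} I → Pointwise _<_ P Q → #below (suc I) Q ≤ #below I P
pointwise-below I [] = z≤n
pointwise-below I (_∷_ {x} {y} {xs} {ys} x<y pw) with y <? suc I | x <? I
... | yes y≤I | yes x<I rewrite below-accept (suc I) ys y≤I | below-accept I xs x<I =
  s≤s (pointwise-below I pw)
... | yes y≤I | no x≮I  = ⊥-elim (x≮I (<-≤-trans x<y (≤-pred y≤I)))
... | no y≰I  | yes x<I rewrite below-reject (suc I) ys y≰I | below-accept I xs x<I =
  m≤n⇒m≤1+n (pointwise-below I pw)
... | no y≰I  | no x≮I  rewrite below-reject (suc I) ys y≰I | below-reject I xs x≮I =
  pointwise-below I pw

-- Arcs are processed in the order of their right ends 1, 2, …; the
-- invariant Matching k A describes the arcs A drawn once 1, …, k are processed.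

module GreedyMatching (R R' : List ℕ) (R-increasing : Linked _<_ R)
                      (columns : Pointwise _<_ (take (length R') R) R') where

  leftEnds rightEnds : List Arc → List ℕ
  leftEnds  = map proj₁
  rightEnds = map proj₂

  record Matching (k : ℕ) (A : List Arc) : Set where
    field
      ends     : ∀ {j i} → (j , i) ∈ A → j ∈ R × i ∈ R' × j < i × i ≤ k
      rightEnds-unique : Unique (rightEnds A)
      left-determines  : ∀ {j i i'} → (j , i) ∈ A → (j , i') ∈ A → i ≡ i'
      greedy   : ∀ {j i j'} → (j , i) ∈ A → j' ∈ R → j < j' → j' < i →
                 ∃[ i' ] ((j' , i') ∈ A × i' < i)
      complete : ∀ {i} → i ∈ R' → 1 ≤ i → i ≤ k → ∃[ j ] ((j , i) ∈ A)

  open Matching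

  module _ {k A} (M : Matching k A) where

    left∈R : ∀ {j i} → (j , i) ∈ A → j ∈ R
    left∈R p = proj₁ (ends M p)

    right∈R' : ∀ {j i} → (j , i) ∈ A → i ∈ R'
    right∈R' p = proj₁ (proj₂ (ends M p))

    left<right : ∀ {j i} → (j , i) ∈ A → j < i
    left<right p = proj₁ (proj₂ (proj₂ (ends M p)))

    right≤ : ∀ {j i} → (j , i) ∈ A → i ≤ k
    right≤ p = proj₂ (proj₂ (proj₂ (ends M p)))

    same-left : ∀ {j i j' i'} → (j , i) ∈ A → (j' , i') ∈ A → j ≡ j' → (j , i) ≡ (j' , i')
    same-left p q refl rewrite left-determines M p q = refl

    same-right : ∀ {j i j' i'} → (j , i) ∈ A → (j' , i') ∈ A → i ≡ i' → (j , i) ≡ (j' , i')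
    same-right p q refl = unique-map-injective proj₂ (rightEnds-unique M) p q refl

  empty : Matching 0 []
  empty = record
    { ends = λ ()
    ; rightEnds-unique = []
    ; left-determines = λ ()
    ; greedy = λ ()
    ; complete = λ { _ (s≤s _) () }
    }

  skip : ∀ {n A} → Matching n A → suc n ∉ R' → Matching (suc n) A
  skip {n} {A} M n+1∉R' = record
    { ends = λ p → let j∈ , i∈ , j<i , i≤n = ends M p in j∈ , i∈ , j<i , m≤n⇒m≤1+n i≤n
    ; rightEnds-unique = rightEnds-unique M
    ; left-determines = left-determines M
    ; greedy = greedy M
    ; complete = complete′
    }
    where
    complete′ : ∀ {i} → i ∈ R' → 1 ≤ i → i ≤ suc n → ∃[ j ] ((j , i) ∈ A)
    complete′ i∈ 1≤i i≤n+1 with m≤n⇒m<n∨m≡n i≤n+1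
    ... | inj₁ i≤n = complete M i∈ 1≤i (≤-pred i≤n)
    ... | inj₂ refl = ⊥-elim (n+1∉R' i∈)

  -- the entries of R below I that stand under an entry of R'
  candidates : ℕ → List ℕ
  candidates I = filter (_<? I) (take (length R') R)

  candidates-unique : ∀ I → Unique (candidates I)
  candidates-unique I = Unique.filter⁺ (_<? I) (Unique.take⁺ (length R')
                          (AllPairs.map <⇒≢ (Linked⇒AllPairs <-trans R-increasing)))

  -- When I ∈ R' is processed there are more candidates than arcs: I and the
  -- right ends of A are distinct entries of R' that are ≤ I, and by column
  -- strictness each of them has a candidate below it.
  arcs<candidates : ∀ {n A} → Matching n A → suc n ∈ R' → length A < length (candidates (suc n))
  arcs<candidates {n} {A} M I∈R' = begin-strict
    length A                ≡⟨ sym (length-map proj₂ A) ⟩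
    length (rightEnds A)    <⟨ pigeonhole I∷rightEnds-unique I∷rightEnds⊆R'≤I ⟩
    #below (suc I) R'       ≤⟨ pointwise-below I columns ⟩
    length (candidates I)   ∎
    where
    open ≤-Reasoning
    I = suc n
    right<I : ∀ {i} → i ∈ rightEnds A → i < I
    right<I i∈ with ∈-map⁻ proj₂ i∈
    ... | _ , p , refl = s≤s (right≤ M p)
    I∷rightEnds-unique : Unique (I ∷ rightEnds A)
    I∷rightEnds-unique = All.tabulate (λ i∈ I≡i → <-irrefl (sym I≡i) (right<I i∈))
                         ∷ rightEnds-unique M
    I∷rightEnds⊆R'≤I : ∀ {i} → i ∈ I ∷ rightEnds A → i ∈ filter (_<? suc I) R'
    I∷rightEnds⊆R'≤I (here refl) = ∈-filter⁺ (_<? suc I) I∈R' ≤-refl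
    I∷rightEnds⊆R'≤I (there i∈) with ∈-map⁻ proj₂ i∈
    ... | _ , p , refl = ∈-filter⁺ (_<? suc I) (right∈R' M p) (m≤n⇒m≤1+n (right<I i∈))

  -- hence, by pigeonhole, some candidate is not yet used as a left end
  free-partner : ∀ {n A} → Matching n A → suc n ∈ R' →
                 ∃[ j ] (j ∈ R × j < suc n × j ∉ leftEnds A)
  free-partner {n} {A} M I∈R' with all? (λ j → any? (j ≟_) (leftEnds A)) (candidates (suc n))
  ... | yes all-used = ⊥-elim (<⇒≱ (arcs<candidates M I∈R') (begin
    length (candidates (suc n))   ≤⟨ pigeonhole (candidates-unique (suc n)) (All.lookup all-used) ⟩
    length (leftEnds A)           ≡⟨ length-map proj₁ A ⟩
    length A                      ∎))
    where open ≤-Reasoning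
  ... | no ¬all-used with find (¬All⇒Any¬ (λ j → any? (j ≟_) (leftEnds A)) _ ¬all-used)
  ...   | j , j∈candidates , j-free with ∈-filter⁻ (_<? suc n) j∈candidates
  ...     | j∈take , j<I = j , ∈-take (length R') j∈take , j<I , j-free

  add-arc : ∀ {n A j} → Matching n A → suc n ∈ R' →
            j ∈ R → j < suc n → j ∉ leftEnds A →
            (∀ {j'} → j' ∈ R → j' < suc n → j' ∉ leftEnds A → j' ≤ j) →
            Matching (suc n) (A ++ [ (j , suc n) ])
  add-arc {n} {A} {j} M I∈R' j∈R j<I j-free j-largest = record
    { ends = ends′
    ; rightEnds-unique = subst Unique (sym (map-++ proj₂ A [ (j , I) ]))
        (Unique.++⁺ (rightEnds-unique M) (All.[] ∷ []) I-new)
    ; left-determines = left-determines′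
    ; greedy = greedy′
    ; complete = complete′
    }
    where
    I = suc n
    A′ = A ++ [ (j , I) ]
    ends′ : ∀ {x y} → (x , y) ∈ A′ → x ∈ R × y ∈ R' × x < y × y ≤ I
    ends′ p with ∈-∷ʳ⁻ p
    ... | inj₁ p′   = let x∈ , y∈ , x<y , y≤n = ends M p′ in x∈ , y∈ , x<y , m≤n⇒m≤1+n y≤n
    ... | inj₂ refl = j∈R , I∈R' , j<I , ≤-refl
    I-new : ∀ {y} → ¬ (y ∈ rightEnds A × y ∈ [ I ])
    I-new (y∈ , here refl) with ∈-map⁻ proj₂ y∈
    ... | _ , p , refl = <-irrefl refl (s≤s (right≤ M p))
    left-determines′ : ∀ {x y y'} → (x , y) ∈ A′ → (x , y') ∈ A′ → y ≡ y'
    left-determines′ p q with ∈-∷ʳ⁻ p | ∈-∷ʳ⁻ q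
    ... | inj₁ p′   | inj₁ q′   = left-determines M p′ q′
    ... | inj₁ p′   | inj₂ refl = ⊥-elim (j-free (∈-map⁺ proj₁ p′))
    ... | inj₂ refl | inj₁ q′   = ⊥-elim (j-free (∈-map⁺ proj₁ q′))
    ... | inj₂ refl | inj₂ refl = refl
    -- inside the new arc every entry of R is used, since j is the largest free one
    greedy′ : ∀ {x y x'} → (x , y) ∈ A′ → x' ∈ R → x < x' → x' < y →
              ∃[ y' ] ((x' , y') ∈ A′ × y' < y)
    greedy′ p x'∈R x<x' x'<y with ∈-∷ʳ⁻ p
    ... | inj₁ p′ = let y' , q , y'<y = greedy M p′ x'∈R x<x' x'<y in y' , ∈-++⁺ˡ q , y'<y
    ... | inj₂ refl with any? (_ ≟_) (leftEnds A)
    ...   | no x'-free = ⊥-elim (<⇒≱ x<x' (j-largest x'∈R x'<y x'-free))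
    ...   | yes x'-used with ∈-map⁻ proj₁ x'-used
    ...     | (_ , y') , q , refl = y' , ∈-++⁺ˡ q , s≤s (right≤ M q)
    complete′ : ∀ {i} → i ∈ R' → 1 ≤ i → i ≤ I → ∃[ x ] ((x , i) ∈ A′)
    complete′ i∈ 1≤i i≤I with m≤n⇒m<n∨m≡n i≤I
    ... | inj₁ i<I  = let x , p = complete M i∈ 1≤i (≤-pred i<I) in x , ∈-++⁺ˡ p
    ... | inj₂ refl = j , ∈-++⁺ʳ A (here refl)

  -- the test by which largestFree selects the free entries of R below I
  free? : ∀ I A j → Dec (j < I × j ∉ leftEnds A)
  free? I A j = (j <? I) ×-dec ¬? (any? (j ≟_) (leftEnds A))

  join : ∀ {n A} → Matching n A → suc n ∈ R' → Matching (suc n) (joinTo (suc n) R A)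
  join {n} {A} M I∈R' with largestFree (suc n) R (leftEnds A) in eq
  ... | nothing = let j , j∈R , j<I , j-free = free-partner M I∈R' in
    ⊥-elim (maxList-nothing eq (∈-filter⁺ (free? (suc n) A) j∈R (j<I , j-free)))
  ... | just j = let j∈R , j<I , j-free = ∈-filter⁻ (free? (suc n) A) (maxList-member eq) in
    add-arc M I∈R' j∈R j<I j-free λ j'∈R j'<I j'-free →
      maxList-upper eq (∈-filter⁺ (free? (suc n) A) j'∈R (j'<I , j'-free))

  -- arcs of a greedy matching never cross: for a < c < b < d the left end c
  -- would be used by an arc shorter than (a , b), yet its arc is (c , d)
  no-interleaving : ∀ {k A a b c d} → Matching k A → (a , b) ∈ A → (c , d) ∈ A →
                    a < c → c < b → ¬ b < d
  no-interleaving M p q a<c c<b b<d with greedy M p (left∈R M q) a<c c<b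
  ... | _ , q′ , d′<b rewrite left-determines M q′ q = <-asym d′<b b<d

  no-crossing : ∀ {k A a b c d} → Matching k A → (a , b) ∈ A → (c , d) ∈ A →
                ¬ Cross (a , b) (c , d)
  no-crossing M p q (inj₁ (a<c , c<b , b<d)) = no-interleaving M p q a<c c<b b<d
  no-crossing M p q (inj₂ (c<a , a<d , d<b)) = no-interleaving M q p c<a a<d d<b

cross-sym : ∀ {e f} → Cross e f → Cross f e
cross-sym (inj₁ x) = inj₂ x
cross-sym (inj₂ x) = inj₁ x

single-crossing : ∀ {a b c a' b' c'} → a < b → b < c → a' < b' → b' < c' →
                  Cross (a , b) (b' , c') → ¬ Cross (b , c) (a' , b')
single-crossing _ _ a'<b' _ (inj₁ (_ , b'<b , _)) (inj₁ (b<a' , _ , _)) =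
  <-asym (<-trans b'<b b<a') a'<b'
single-crossing _ _ _ _ (inj₁ (_ , b'<b , _)) (inj₂ (_ , b<b' , _)) =
  <-asym b'<b b<b'
single-crossing a<b b<c _ _ (inj₂ (b'<a , _ , _)) (inj₁ (_ , _ , c<b')) =
  <-asym (<-trans b'<a a<b) (<-trans b<c c<b')
single-crossing _ _ _ b'<c' (inj₂ (_ , _ , c'<b)) (inj₂ (_ , b<b' , _)) =
  <-asym (<-trans c'<b b<b') b'<c'

Apart NestedInSecond NestedInFirst FirstCrossed SecondCrossed : (a b c a' b' c' : ℕ) → Set
Apart          a b c a' b' c' = c < a'
NestedInSecond a b c a' b' c' = b < a' × a' < c' × c' < c
NestedInFirst  a b c a' b' c' = a < a' × a' < c' × c' < b
FirstCrossed   a b c a' b' c' = a < a' × a' < b' × b' < b × b < c × c < c'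
SecondCrossed  a b c a' b' c' = a < b × b < a' × a' < c × c < b' × b' < c'

Positions : (a b c a' b' c' : ℕ) → Set
Positions a b c a' b' c' =
  Apart a b c a' b' c' ⊎ NestedInSecond a b c a' b' c' ⊎ NestedInFirst a b c a' b' c' ⊎
  FirstCrossed a b c a' b' c' ⊎ SecondCrossed a b c a' b' c'

positions-exhaustive : ∀ {a b c a' b' c'} → a < b → b < c → a' < b' → b' < c' → a < a' →
  ¬ Cross (a , b) (a' , b') → ¬ Cross (b , c) (b' , c') →
  b ≢ a' → c ≢ a' → c ≢ b' → c' ≢ b → b ≢ b' → c ≢ c' → Positions a b c a' b' c'
positions-exhaustive {a} {b} {c} {a'} {b'} {c'} a<b b<c a'<b' b'<c' a<a' ¬cross₁ ¬cross₂
                     b≢a' c≢a' c≢b' c'≢b b≢b' c≢c' with <-cmp b a'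
... | tri< b<a' _ _ = after-first-arc b<a'
  where
  after-first-arc : b < a' → Positions a b c a' b' c'
  after-first-arc b<a' with <-cmp c b'
  ... | tri≈ _ c≡b' _ = ⊥-elim (c≢b' c≡b')
  ... | tri< c<b' _ _ with <-cmp c a'
  ...   | tri< c<a' _ _ = inj₁ c<a'
  ...   | tri≈ _ c≡a' _ = ⊥-elim (c≢a' c≡a')
  ...   | tri> _ _ a'<c = inj₂ (inj₂ (inj₂ (inj₂ (a<b , b<a' , a'<c , c<b' , b'<c'))))
  after-first-arc b<a' | tri> _ _ b'<c with <-cmp c c'
  ...   | tri< c<c' _ _ = ⊥-elim (¬cross₂ (inj₁ (<-trans b<a' a'<b' , b'<c , c<c')))
  ...   | tri≈ _ c≡c' _ = ⊥-elim (c≢c' c≡c')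
  ...   | tri> _ _ c'<c = inj₂ (inj₁ (b<a' , <-trans a'<b' b'<c' , c'<c))
... | tri≈ _ b≡a' _ = ⊥-elim (b≢a' b≡a')
... | tri> _ _ a'<b = under-first-arc a'<b
  where
  -- a' lies under the first arc, hence so does b' as first arcs do not cross
  under-first-arc : a' < b → Positions a b c a' b' c'
  under-first-arc a'<b with <-cmp b b'
  ... | tri< b<b' _ _ = ⊥-elim (¬cross₁ (inj₁ (a<a' , a'<b , b<b')))
  ... | tri≈ _ b≡b' _ = ⊥-elim (b≢b' b≡b')
  ... | tri> _ _ b'<b with <-cmp c' b
  ...   | tri< c'<b _ _ = inj₂ (inj₂ (inj₁ (a<a' , <-trans a'<b' b'<c' , c'<b)))
  ...   | tri≈ _ c'≡b _ = ⊥-elim (c'≢b c'≡b)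
  ...   | tri> _ _ b<c' with <-cmp c c'
  ...     | tri< c<c' _ _ = inj₂ (inj₂ (inj₂ (inj₁ (a<a' , a'<b' , b'<b , b<c , c<c'))))
  ...     | tri≈ _ c≡c' _ = ⊥-elim (c≢c' c≡c')
  ...     | tri> _ _ c'<c = ⊥-elim (¬cross₂ (inj₂ (b'<b , b<c' , c'<c)))

relative-position : ∀ {a b c a' b' c'} → a < b → b < c → a' < b' → b' < c' → a < a' →
  ¬ Cross (a , b) (a' , b') → ¬ Cross (b , c) (b' , c') →
  b ≢ a' → c ≢ a' → c ≢ b' → c' ≢ b → b ≢ b' → c ≢ c' →
  ExactlyOne5 (Apart a b c a' b' c') (NestedInSecond a b c a' b' c') (NestedInFirst a b c a' b' c')
              (FirstCrossed a b c a' b' c') (SecondCrossed a b c a' b' c')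
relative-position a<b b<c a'<b' b'<c' a<a' ¬cross₁ ¬cross₂ b≢a' c≢a' c≢b' c'≢b b≢b' c≢c' =
  positions-exhaustive a<b b<c a'<b' b'<c' a<a' ¬cross₁ ¬cross₂ b≢a' c≢a' c≢b' c'≢b b≢b' c≢c' ,
  (λ { (c<a' , (_ , a'<c' , c'<c)) → <-asym c<a' (<-trans a'<c' c'<c) }) ,
  (λ { (c<a' , (_ , a'<c' , c'<b)) → <-asym c<a' (<-trans a'<c' (<-trans c'<b b<c)) }) ,
  (λ { (c<a' , (_ , a'<b' , b'<b , b<c , _)) → <-asym c<a' (<-trans a'<b' (<-trans b'<b b<c)) }) ,
  (λ { (c<a' , (_ , _ , a'<c , _ , _)) → <-asym c<a' a'<c }) ,
  (λ { ((b<a' , _ , _) , (_ , a'<c' , c'<b)) → <-asym b<a' (<-trans a'<c' c'<b) }) ,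
  (λ { ((b<a' , _ , _) , (_ , a'<b' , b'<b , _ , _)) → <-asym b<a' (<-trans a'<b' b'<b) }) ,
  (λ { ((_ , _ , c'<c) , (_ , _ , _ , c<b' , b'<c')) → <-asym c'<c (<-trans c<b' b'<c') }) ,
  (λ { ((_ , _ , c'<b) , (_ , _ , _ , b<c , c<c')) → <-asym c'<b (<-trans b<c c<c') }) ,
  (λ { ((_ , a'<c' , c'<b) , (_ , b<a' , _ , _ , _)) → <-asym (<-trans a'<c' c'<b) b<a' }) ,
  (λ { ((_ , _ , b'<b , _ , _) , (_ , b<a' , a'<c , c<b' , _)) →
         <-asym b'<b (<-trans b<a' (<-trans a'<c c<b')) })

module ThreeRows {N : ℕ} (T : SYT3 N) where

  r₁ r₂ r₃ : List ℕ
  r₁ = row₁ T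
  r₂ = row₂ T
  r₃ = row₃ T

  entries-unique : Unique (r₁ ++ r₂ ++ r₃)
  entries-unique = unique-resp-↭ (↭-sym (entries T)) (Unique.map⁺ suc-injective (Unique.upTo⁺ N))

  disjoint₁₂ : ∀ {x} → x ∈ r₁ → x ∉ r₂
  disjoint₁₂ x∈r₁ x∈r₂ = unique-++-disjoint r₁ entries-unique x∈r₁ (∈-++⁺ˡ x∈r₂)

  disjoint₁₃ : ∀ {x} → x ∈ r₁ → x ∉ r₃
  disjoint₁₃ x∈r₁ x∈r₃ = unique-++-disjoint r₁ entries-unique x∈r₁ (∈-++⁺ʳ r₂ x∈r₃)

  disjoint₂₃ : ∀ {x} → x ∈ r₂ → x ∉ r₃
  disjoint₂₃ = unique-++-disjoint r₂ (unique-++ʳ r₁ entries-unique)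

  row₂-range : ∀ {x} → x ∈ r₂ → 1 ≤ x × x ≤ N
  row₂-range x∈r₂ with ∈-map⁻ suc (∈-resp-↭ (entries T) (∈-++⁺ʳ r₁ (∈-++⁺ˡ x∈r₂)))
  ... | y , y∈ , refl = s≤s z≤n , ∈-upTo⁻ y∈

  module First  = GreedyMatching r₁ r₂ (inc₁ T) (col₁₂ T)
  module Second = GreedyMatching r₂ r₃ (inc₂ T) (col₂₃ T)

  Invariant : ℕ → Diagram → Set
  Invariant k D = First.Matching k (firstArcs D) × Second.Matching k (secondArcs D)

  step-preserves : ∀ {n} fs ss → Invariant n (mkDiagram fs ss) →
                   Invariant (suc n) (step r₁ r₂ r₃ (mkDiagram fs ss) (suc n))
  step-preserves {n} fs ss (M₁ , M₂) with any? (suc n ≟_) r₂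
  ... | yes ∈r₂ = First.join M₁ ∈r₂ , Second.skip M₂ (disjoint₂₃ ∈r₂)
  ... | no ∉r₂ with any? (suc n ≟_) r₃
  ...   | yes ∈r₃ = First.skip M₁ ∉r₂ , Second.join M₂ ∈r₃
  ...   | no ∉r₃  = First.skip M₁ ∉r₂ , Second.skip M₂ ∉r₃

  diagramUpTo : ℕ → Diagram
  diagramUpTo n = foldl (step r₁ r₂ r₃) (mkDiagram [] []) (map suc (upTo n))

  diagramUpTo-suc : ∀ n → diagramUpTo (suc n) ≡ step r₁ r₂ r₃ (diagramUpTo n) (suc n)
  diagramUpTo-suc n = begin
    foldl st d₀ (map suc (upTo (suc n)))          ≡⟨ cong (λ xs → foldl st d₀ (map suc xs)) (sym (upTo-∷ʳ n)) ⟩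
    foldl st d₀ (map suc (upTo n ++ [ n ]))       ≡⟨ cong (foldl st d₀) (map-++ suc (upTo n) [ n ]) ⟩
    foldl st d₀ (map suc (upTo n) ++ [ suc n ])   ≡⟨ foldl-∷ʳ st d₀ (suc n) (map suc (upTo n)) ⟩
    st (diagramUpTo n) (suc n)                    ∎
    where
    open ≡-Reasoning
    st = step r₁ r₂ r₃
    d₀ = mkDiagram [] []

  invariant : ∀ n → Invariant n (diagramUpTo n)
  invariant zero    = First.empty , Second.empty
  invariant (suc n) = subst (Invariant (suc n)) (sym (diagramUpTo-suc n))
    (step-preserves (firstArcs (diagramUpTo n)) (secondArcs (diagramUpTo n)) (invariant n))

  D : Diagram
  D = mDiagram T

  F S : List Arc
  F = firstArcs D
  S = secondArcs D

  MF : First.Matching N F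
  MF = proj₁ (invariant N)

  MS : Second.Matching N S
  MS = proj₂ (invariant N)

  F-left : ∀ {a b} → (a , b) ∈ F → a ∈ r₁
  F-left = First.left∈R MF

  F-right : ∀ {a b} → (a , b) ∈ F → b ∈ r₂
  F-right = First.right∈R' MF

  S-left : ∀ {a b} → (a , b) ∈ S → a ∈ r₂
  S-left = Second.left∈R MS

  S-right : ∀ {a b} → (a , b) ∈ S → b ∈ r₃
  S-right = Second.right∈R' MS

  first-arc-into : ∀ {b} → b ∈ r₂ → ∃[ a ] ((a , b) ∈ F)
  first-arc-into b∈ = First.Matching.complete MF b∈ (proj₁ (row₂-range b∈)) (proj₂ (row₂-range b∈))

  at-row₁ : ∀ {v x y} → v ∈ r₁ → (x , y) ∈ arcs D → Incident v (x , y) → (x , y) ∈ F × x ≡ v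
  at-row₁ v∈ e∈ v-on with ∈-++⁻ F e∈ | v-on
  ... | inj₁ p | inj₁ refl = p , refl
  ... | inj₁ p | inj₂ refl = ⊥-elim (disjoint₁₂ v∈ (F-right p))
  ... | inj₂ q | inj₁ refl = ⊥-elim (disjoint₁₂ v∈ (S-left q))
  ... | inj₂ q | inj₂ refl = ⊥-elim (disjoint₁₃ v∈ (S-right q))

  at-row₂ : ∀ {v x y} → v ∈ r₂ → (x , y) ∈ arcs D → Incident v (x , y) →
            ((x , y) ∈ F × y ≡ v) ⊎ ((x , y) ∈ S × x ≡ v)
  at-row₂ v∈ e∈ v-on with ∈-++⁻ F e∈ | v-on
  ... | inj₁ p | inj₁ refl = ⊥-elim (disjoint₁₂ (F-left p) v∈)
  ... | inj₁ p | inj₂ refl = inj₁ (p , refl)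
  ... | inj₂ q | inj₁ refl = inj₂ (q , refl)
  ... | inj₂ q | inj₂ refl = ⊥-elim (disjoint₂₃ v∈ (S-right q))

  at-row₃ : ∀ {v x y} → v ∈ r₃ → (x , y) ∈ arcs D → Incident v (x , y) → (x , y) ∈ S × y ≡ v
  at-row₃ v∈ e∈ v-on with ∈-++⁻ F e∈ | v-on
  ... | inj₁ p | inj₁ refl = ⊥-elim (disjoint₁₃ (F-left p) v∈)
  ... | inj₁ p | inj₂ refl = ⊥-elim (disjoint₂₃ (F-right p) v∈)
  ... | inj₂ q | inj₁ refl = ⊥-elim (disjoint₂₃ (S-left q) v∈)
  ... | inj₂ q | inj₂ refl = q , refl

  row-of-incident : ∀ {v x y} → (x , y) ∈ arcs D → Incident v (x , y) → v ∈ r₁ ⊎ v ∈ r₂ ⊎ v ∈ r₃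
  row-of-incident e∈ v-on with ∈-++⁻ F e∈ | v-on
  ... | inj₁ p | inj₁ refl = inj₁ (F-left p)
  ... | inj₁ p | inj₂ refl = inj₂ (inj₁ (F-right p))
  ... | inj₂ q | inj₁ refl = inj₂ (inj₁ (S-left q))
  ... | inj₂ q | inj₂ refl = inj₂ (inj₂ (S-right q))

  -- Property (1), at a vertex: a vertex lies on at most one arc of each kind
  two-arcs-at-vertex : ∀ v {e₁ e₂ e₃} → e₁ ∈ arcs D → e₂ ∈ arcs D → e₃ ∈ arcs D →
                       Incident v e₁ → Incident v e₂ → Incident v e₃ →
                       e₁ ≡ e₂ ⊎ e₁ ≡ e₃ ⊎ e₂ ≡ e₃
  two-arcs-at-vertex v {_ , _} {_ , _} {_ , _} m₁ m₂ m₃ i₁ i₂ i₃ with row-of-incident m₁ i₁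
  ... | inj₁ v∈r₁ with at-row₁ v∈r₁ m₁ i₁ | at-row₁ v∈r₁ m₂ i₂
  ...   | p , refl | q , refl = inj₁ (First.same-left MF p q refl)
  two-arcs-at-vertex v m₁ m₂ m₃ i₁ i₂ i₃ | inj₂ (inj₂ v∈r₃) with at-row₃ v∈r₃ m₁ i₁ | at-row₃ v∈r₃ m₂ i₂
  ...   | p , refl | q , refl = inj₁ (Second.same-right MS p q refl)
  two-arcs-at-vertex v m₁ m₂ m₃ i₁ i₂ i₃ | inj₂ (inj₁ v∈r₂)
    with at-row₂ v∈r₂ m₁ i₁ | at-row₂ v∈r₂ m₂ i₂ | at-row₂ v∈r₂ m₃ i₃
  ... | inj₁ (p , refl) | inj₁ (q , refl) | _               = inj₁ (First.same-right MF p q refl)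
  ... | inj₂ (p , refl) | inj₂ (q , refl) | _               = inj₁ (Second.same-left MS p q refl)
  ... | inj₁ (p , refl) | inj₂ _          | inj₁ (q , refl) = inj₂ (inj₁ (First.same-right MF p q refl))
  ... | inj₂ (p , refl) | inj₁ _          | inj₂ (q , refl) = inj₂ (inj₁ (Second.same-left MS p q refl))
  ... | inj₁ _          | inj₂ (p , refl) | inj₂ (q , refl) = inj₂ (inj₂ (Second.same-left MS p q refl))
  ... | inj₂ _          | inj₁ (p , refl) | inj₁ (q , refl) = inj₂ (inj₂ (First.same-right MF p q refl))

  -- Property (1), above the line: of three arcs two have the same kind,
  -- and arcs of the same kind do not cross
  no-three-crossing : ∀ {e₁ e₂ e₃} → e₁ ∈ arcs D → e₂ ∈ arcs D → e₃ ∈ arcs D →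
                      ¬ (Cross e₁ e₂ × Cross e₁ e₃ × Cross e₂ e₃)
  no-three-crossing {_ , _} {_ , _} {_ , _} m₁ m₂ m₃ (c₁₂ , c₁₃ , c₂₃)
    with ∈-++⁻ F m₁ | ∈-++⁻ F m₂ | ∈-++⁻ F m₃
  ... | inj₁ p | inj₁ q | _      = First.no-crossing MF p q c₁₂
  ... | inj₂ p | inj₂ q | _      = Second.no-crossing MS p q c₁₂
  ... | inj₁ p | inj₂ _ | inj₁ q = First.no-crossing MF p q c₁₃
  ... | inj₂ p | inj₁ _ | inj₂ q = Second.no-crossing MS p q c₁₃
  ... | inj₁ _ | inj₂ p | inj₂ q = Second.no-crossing MS p q c₂₃
  ... | inj₂ _ | inj₁ p | inj₁ q = First.no-crossing MF p q c₂₃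

  m-of-arcs : ∀ {a b c} → (a , b) ∈ F → (b , c) ∈ S → IsM D a b c
  m-of-arcs {a} {b} {c} p q =
    First.left<right MF p , Second.left<right MS q , ∈-++⁺ˡ p , ∈-++⁺ʳ F q , only-arcs
    where
    only-arcs : ∀ e → e ∈ arcs D → Incident a e ⊎ Incident b e ⊎ Incident c e →
                e ≡ (a , b) ⊎ e ≡ (b , c)
    only-arcs (x , y) e∈ (inj₁ a-on) with at-row₁ (F-left p) e∈ a-on
    ... | p′ , refl = inj₁ (First.same-left MF p′ p refl)
    only-arcs (x , y) e∈ (inj₂ (inj₁ b-on)) with at-row₂ (F-right p) e∈ b-on
    ... | inj₁ (p′ , refl) = inj₁ (First.same-right MF p′ p refl)
    ... | inj₂ (q′ , refl) = inj₂ (Second.same-left MS q′ q refl)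
    only-arcs (x , y) e∈ (inj₂ (inj₂ c-on)) with at-row₃ (S-right q) e∈ c-on
    ... | q′ , refl = inj₂ (Second.same-right MS q′ q refl)

  arcs-of-m : ∀ {a b c} → IsM D a b c → (a , b) ∈ F × (b , c) ∈ S
  arcs-of-m (_ , _ , m₁ , m₂ , _) with ∈-++⁻ F m₁ | ∈-++⁻ F m₂
  ... | inj₁ p | inj₂ q = p , q
  ... | inj₁ p | inj₁ p′ = ⊥-elim (disjoint₁₂ (F-left p′) (F-right p))
  ... | inj₂ q | inj₁ p′ = ⊥-elim (disjoint₁₃ (F-left p′) (S-right q))
  ... | inj₂ q | inj₂ q′ = ⊥-elim (disjoint₂₃ (S-left q′) (S-right q))

  -- The
  -- entry b' of row 2 carries a first arc (a' , b'), giving the m (a' , b' , c');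
  -- (a , b) is isolated or starts an m, which differs as b ≢ b'.
  first-vs-second : ∀ {a b b' c'} → (a , b) ∈ F → (b' , c') ∈ S → Cross (a , b) (b' , c') →
                    FirstVsSecond D (a , b) (b' , c')
  first-vs-second {a} {b} {b'} {c'} p q crosses with first-arc-into (S-left q)
  ... | a' , p′ with any? (λ e → proj₁ e ≟ b) S
  ...   | yes continues with find continues
  ...     | (_ , c) , q′ , refl =
    p , inj₁ (c , a' , m-of-arcs p q′ , m-of-arcs p′ q , λ { (_ , b≡b' , _) → b≢b' crosses b≡b' })
    where
    b≢b' : Cross (a , b) (b' , c') → b ≢ b'
    b≢b' (inj₁ (_ , b'<b , _))   b≡b' = <-irrefl (sym b≡b') b'<b
    b≢b' (inj₂ (b'<a , _ , _))   b≡b' = <-irrefl (sym b≡b') (<-trans b'<a (First.left<right MF p))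
  first-vs-second {a} {b} p q crosses | a' , p′ | no ends-here =
    p , inj₂ ((∈-++⁺ˡ p , isolated) , a' , m-of-arcs p′ q)
    where
    isolated : ∀ f → f ∈ arcs D → Incident a f ⊎ Incident b f → f ≡ (a , b)
    isolated (x , y) f∈ (inj₁ a-on) with at-row₁ (F-left p) f∈ a-on
    ... | p″ , refl = First.same-left MF p″ p refl
    isolated (x , y) f∈ (inj₂ b-on) with at-row₂ (F-right p) f∈ b-on
    ... | inj₁ (p″ , refl) = First.same-right MF p″ p refl
    ... | inj₂ (q″ , refl) = ⊥-elim (ends-here (lose q″ refl))

  property2 : Property2 D
  property2 {_ , _} {_ , _} e∈ f∈ crosses with ∈-++⁻ F e∈ | ∈-++⁻ F f∈
  ... | inj₁ p | inj₁ p′ = ⊥-elim (First.no-crossing MF p p′ crosses)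
  ... | inj₂ q | inj₂ q′ = ⊥-elim (Second.no-crossing MS q q′ crosses)
  ... | inj₁ p | inj₂ q  = inj₁ (first-vs-second p q crosses)
  ... | inj₂ q | inj₁ p  = inj₂ (first-vs-second p q (cross-sym crosses))

  -- a crossing between arcs of two m's joins the first arc of one to the
  -- second arc of the other, since arcs of the same kind do not cross
  crossing-of-ms : ∀ {a b c a' b' c' e f} → (a , b) ∈ F → (b , c) ∈ S → (a' , b') ∈ F → (b' , c') ∈ S →
    ArcOfM a b c e → ArcOfM a' b' c' f → Cross e f →
    (e ≡ (a , b) × f ≡ (b' , c') × Cross (a , b) (b' , c')) ⊎
    (e ≡ (b , c) × f ≡ (a' , b') × Cross (b , c) (a' , b'))
  crossing-of-ms p q p′ q′ (inj₁ refl) (inj₁ refl) crosses = ⊥-elim (First.no-crossing MF p p′ crosses)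
  crossing-of-ms p q p′ q′ (inj₁ refl) (inj₂ refl) crosses = inj₁ (refl , refl , crosses)
  crossing-of-ms p q p′ q′ (inj₂ refl) (inj₁ refl) crosses = inj₂ (refl , refl , crosses)
  crossing-of-ms p q p′ q′ (inj₂ refl) (inj₂ refl) crosses = ⊥-elim (Second.no-crossing MS q q′ crosses)

  -- Property (3): two crossings of the same pair of m's are of the same type,
  -- and by single-crossing only one type can occur
  property3 : Property3 D
  property3 M@(a<b , b<c , _) M′@(a'<b' , b'<c' , _) _ e₁∈ f₁∈ c₁ e₂∈ f₂∈ c₂
    with arcs-of-m M | arcs-of-m M′
  ... | p , q | p′ , q′ with crossing-of-ms p q p′ q′ e₁∈ f₁∈ c₁ | crossing-of-ms p q p′ q′ e₂∈ f₂∈ c₂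
  ...   | inj₁ (refl , refl , _) | inj₁ (refl , refl , _) = refl , refl
  ...   | inj₂ (refl , refl , _) | inj₂ (refl , refl , _) = refl , refl
  ...   | inj₁ (_ , _ , x)       | inj₂ (_ , _ , y)       = ⊥-elim (single-crossing a<b b<c a'<b' b'<c' x y)
  ...   | inj₂ (_ , _ , y)       | inj₁ (_ , _ , x)       = ⊥-elim (single-crossing a<b b<c a'<b' b'<c' x y)

  -- Property (4): relative-position applies since arcs of one kind do not
  -- cross, endpoints in different rows differ, and b ≢ b' (hence c ≢ c')
  -- because distinct m's share no arc
  property4 : Property4 D
  property4 {a} {b} {c} {a'} {b'} {c'} M@(a<b , b<c , _) M′@(a'<b' , b'<c' , _) distinct a<a'
    with arcs-of-m M | arcs-of-m M′
  ... | p , q | p′ , q′ =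
    relative-position a<b b<c a'<b' b'<c' a<a'
      (First.no-crossing MF p p′) (Second.no-crossing MS q q′)
      (λ b≡a' → distinct-of-disjoint disjoint₁₂ (F-left p′) (F-right p) (sym b≡a'))
      (λ c≡a' → distinct-of-disjoint disjoint₁₃ (F-left p′) (S-right q) (sym c≡a'))
      (λ c≡b' → distinct-of-disjoint disjoint₂₃ (F-right p′) (S-right q) (sym c≡b'))
      (λ c'≡b → distinct-of-disjoint disjoint₂₃ (F-right p) (S-right q′) (sym c'≡b))
      b≢b' (λ c≡c' → b≢b' (cong proj₁ (Second.same-right MS q q′ c≡c')))
    where
    b≢b' : b ≢ b'
    b≢b' b≡b' = distinct (cong proj₁ (First.same-right MF p p′ b≡b') , b≡b' ,
                          cong proj₂ (Second.same-left MS q q′ b≡b'))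

corollary2p5 : (N : ℕ) (T : SYT3 N) →
    Property1 (mDiagram T) × Property2 (mDiagram T) ×
    Property3 (mDiagram T) × Property4 (mDiagram T)
corollary2p5 N T =
  (two-arcs-at-vertex , no-three-crossing) , property2 , property3 , property4
  where open ThreeRows T
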